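{- Let $n\ge 17$. For each integer $a$ with $4\le a\le \lfloor (n+3)/5\rfloor$ and $n-a\equiv 1\pmod 2$, and each integer $b$ with $2\le b\le a-2$, the partition $\left(\tfrac12(n-a+1-2b),\ a+1,\ b+2,\ 2\times(b-1),\ 1\times \tfrac12(n-a-3-4b)\right)$ of $n$ corresponds to the eigenvalue $\binom{a}{2}-b$ of $\mathrm{Cay}(S_n,T_n)$.
   Context: $\mathrm{Cay}(S_n,T_n)$ is the Cayley graph on the symmetric group $S_n$ generated by the set $T_n$ of all transpositions ($f\sim g$ iff $fg^{ -1}\in T_n$). For a partition $\lambda=(\lambda_1,\dots,\lambda_k)$ of $n$ (parts listed in the order written), put $\rho_\lambda=\sum_{i=1}^k \lambda_i(\lambda_i-2i+1)/2$; the eigenvalues of $\mathrm{Cay}(S_n,T_n)$ are exactly the numbers $\rho_\lambda$ as $\lambda$ ranges over partitions of $n$, and $\lambda$ is said to correspond to the eigenvalue $\rho_\lambda$. The notation $(\mu_1\times t_1,\dots,\mu_r\times t_r)$ denotes the sequence in which $\mu_i$ is repeated $t_i$ times; an entry $\mu$ without "$\times t$" is a single part, and $\mu\times 0$ contributes no parts. -}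

module Defs where

open import Data.Nat as ℕ using (ℕ; zero; suc; _≤_; _<_; _≥_)
open import Data.Integer as ℤ using (ℤ; +_)
open import Data.Integer.DivMod using (_/_)
open import Data.List using (List; []; _∷_; replicate; _++_)
open import Data.Nat.ListAction using (sum)
open import Data.List.Relation.Unary.All using (All)
open import Data.List.Relation.Unary.Linked using (Linked)
open import Data.Product using (_×_)
open import Relation.Binary.PropositionalEquality using (_≡_)

IsPartitionOf : ℕ → List ℕ → Set
IsPartitionOf n λs = (sum λs ≡ n) × All (0 <_) λs × Linked _≥_ λs

-- ρ-from i λ = Σ_{j} λ_j (λ_j - 2(i+j) + 1) / 2, where the first entry of λ has index i
-- (each summand is an even integer, so the division by 2 is exact).
ρ-from : ℕ → List ℕ → ℤ
ρ-from i [] = + 0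
ρ-from i (l ∷ ls) =
  ((+ l) ℤ.* ((+ l) ℤ.- (+ 2) ℤ.* (+ i) ℤ.+ (+ 1))) / (+ 2) ℤ.+ ρ-from (suc i) ls

ρ : List ℕ → ℤ
ρ = ρ-from 1

λ₃₃ : ℕ → ℕ → ℕ → List ℕ
λ₃₃ n a b =
  ((n ℕ.∸ a ℕ.+ 1 ℕ.∸ 2 ℕ.* b) ℕ./ 2) ∷ (a ℕ.+ 1) ∷ (b ℕ.+ 2) ∷
  (replicate (b ℕ.∸ 1) 2 ++ replicate ((n ℕ.∸ a ℕ.∸ 3 ℕ.∸ 4 ℕ.* b) ℕ./ 2) 1)

{-# OPTIONS --safe #-}
-- Twice the content sum is a polynomial in the row lengths: a row of length l at index i
-- contributes l (l - 2i + 1), and k equal rows of length x starting at index i contribute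
-- k x (x - 2i - k + 2). Write b = 2 + β, a = 4 + β + σ and n = a + 2c + 1 (n - a is odd).
-- Then 5a ≤ n + 3 means c ≥ 2a - 2, i.e. c = 6 + 2β + σ + t with t ≥ σ, and the partition
-- becomes (5+β+σ+t, 5+β+σ, 4+β, 2×(1+β), 1×(1+σ+t)): none of its truncated subtractions
-- truncates, and 2ρ = a (a - 1) - 2b is a polynomial identity in β, σ, t.
module Submission where

open import Defs
open import Data.Nat.Combinatorics using (_C_; nC1≡n; nCk+nC[k+1]≡[n+1]C[k+1])
open import Data.List using (List; []; _∷_; _++_; replicate; length)
open import Relation.Binary.PropositionalEquality using (_≡_; refl; sym; trans; cong; cong₂; subst; subst₂; module ≡-Reasoning)

import Data.Nat as ℕ
open import Data.Nat using (ℕ; zero; suc)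
import Data.Nat.Properties as ℕ
import Data.Nat.DivMod as ℕ

shape : ℕ → ℕ → ℕ → ℕ → ℕ → List ℕ
shape p q r k m = p ∷ q ∷ r ∷ replicate k 2 ++ replicate m 1

module Eigenvalue where

  open import Data.Integer using (ℤ; +_; -[1+_]; _+_; _-_; -_; _*_; _/_; _/ℕ_)
  open import Data.Integer.DivMod using (div-pos-is-/ℕ)
  open import Data.Integer.Properties using (pos-*; *-distribʳ-+; +-identityˡ; +-assoc; *-cancelʳ-≡)
  open import Data.Integer.Tactic.RingSolver using (solve-∀)
  open import Data.List.Properties using (length-replicate)
  open ≡-Reasoning

  i*n/n≡i : ∀ i n .{{_ : ℕ.NonZero n}} → (i * + n) / + n ≡ i
  i*n/n≡i (+ k) n = begin
    (+ k * + n) / + n    ≡⟨ cong (_/ + n) (pos-* k n) ⟨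
    + (k ℕ.* n) / + n    ≡⟨ div-pos-is-/ℕ (+ (k ℕ.* n)) n ⟩
    + (k ℕ.* n ℕ./ n)    ≡⟨ cong +_ (ℕ.m*n/n≡m k n) ⟩
    + k                  ∎
  i*n/n≡i -[1+ k ] n@(suc _) = begin
    (-[1+ k ] * + n) / + n        ≡⟨ div-pos-is-/ℕ (-[1+ k ] * + n) n ⟩
    -[1+ k ] * + n /ℕ n           ≡⟨ -[1+m]/ℕn (ℕ.m*n%n≡0 (suc k) n) ⟩
    - + (suc k ℕ.* n ℕ./ n)       ≡⟨ cong (λ q → - + q) (ℕ.m*n/n≡m (suc k) n) ⟩
    -[1+ k ]                      ∎
    where
    -[1+m]/ℕn : ∀ {m} → suc m ℕ.% n ≡ 0 → -[1+ m ] /ℕ n ≡ - + (suc m ℕ./ n)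
    -[1+m]/ℕn eq rewrite eq = refl

  [1+n]C2*2≡[1+n]*n : ∀ n → (suc n C 2) ℕ.* 2 ≡ suc n ℕ.* n
  [1+n]C2*2≡[1+n]*n zero = refl
  [1+n]C2*2≡[1+n]*n (suc n) = begin
    (suc (suc n) C 2) ℕ.* 2                     ≡⟨ cong (ℕ._* 2) (nCk+nC[k+1]≡[n+1]C[k+1] (suc n) 1) ⟨
    (suc n C 1 ℕ.+ suc n C 2) ℕ.* 2             ≡⟨ ℕ.*-distribʳ-+ 2 (suc n C 1) (suc n C 2) ⟩
    (suc n C 1) ℕ.* 2 ℕ.+ (suc n C 2) ℕ.* 2     ≡⟨ cong₂ (λ x y → x ℕ.* 2 ℕ.+ y) (nC1≡n (suc n)) ([1+n]C2*2≡[1+n]*n n) ⟩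
    suc n ℕ.* 2 ℕ.+ suc n ℕ.* n                 ≡⟨ ℕ.*-distribˡ-+ (suc n) 2 n ⟨
    suc n ℕ.* suc (suc n)                       ≡⟨ ℕ.*-comm (suc n) (suc (suc n)) ⟩
    suc (suc n) ℕ.* suc n                       ∎

  +[1+n]C2*2≡+[1+n]*+n : ∀ n → + (suc n C 2) * + 2 ≡ + suc n * + n
  +[1+n]C2*2≡+[1+n]*+n n = begin
    + (suc n C 2) * + 2        ≡⟨ pos-* (suc n C 2) 2 ⟨
    + ((suc n C 2) ℕ.* 2)      ≡⟨ cong +_ ([1+n]C2*2≡[1+n]*n n) ⟩
    + (suc n ℕ.* n)            ≡⟨ pos-* (suc n) n ⟩
    + suc n * + n              ∎

  [i-j]*k≡i*k-j*k : ∀ i j k → (i - j) * k ≡ i * k - j * k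
  [i-j]*k≡i*k-j*k = solve-∀

  -- l (l - 2i + 1) = 2 (C(l+1, 2) - i l), so the division by 2 in ρ-from is exact.
  ρ-from-∷ : ∀ i l ls → ρ-from i (l ∷ ls) * + 2 ≡ + l * (+ l - + 2 * + i + + 1) + ρ-from (suc i) ls * + 2
  ρ-from-∷ i l ls = begin
    (term / + 2 + rest) * + 2            ≡⟨ *-distribʳ-+ (+ 2) (term / + 2) rest ⟩
    term / + 2 * + 2 + rest * + 2        ≡⟨ cong (λ x → x / + 2 * + 2 + rest * + 2) term≡half*2 ⟩
    half * + 2 / + 2 * + 2 + rest * + 2  ≡⟨ cong (λ h → h * + 2 + rest * + 2) (i*n/n≡i half 2) ⟩
    half * + 2 + rest * + 2              ≡⟨ cong (_+ rest * + 2) term≡half*2 ⟨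
    term + rest * + 2                    ∎
    where
    term half rest : ℤ
    term = + l * (+ l - + 2 * + i + + 1)
    half = + (suc l C 2) - + i * + l
    rest = ρ-from (suc i) ls
    expand : ∀ I L → L * (L - + 2 * I + + 1) ≡ (+ 1 + L) * L - I * L * + 2
    expand = solve-∀
    term≡half*2 : term ≡ half * + 2
    term≡half*2 = begin
      term                                   ≡⟨ expand (+ i) (+ l) ⟩
      + suc l * + l - + i * + l * + 2        ≡⟨ cong (_- + i * + l * + 2) (+[1+n]C2*2≡+[1+n]*+n l) ⟨
      + (suc l C 2) * + 2 - + i * + l * + 2  ≡⟨ [i-j]*k≡i*k-j*k (+ (suc l C 2)) (+ i * + l) (+ 2) ⟨
      half * + 2                             ∎

  ρ-from-++ : ∀ i xs ys → ρ-from i (xs ++ ys) ≡ ρ-from i xs + ρ-from (i ℕ.+ length xs) ys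
  ρ-from-++ i [] ys = begin
    ρ-from i ys                 ≡⟨ cong (λ j → ρ-from j ys) (ℕ.+-identityʳ i) ⟨
    ρ-from (i ℕ.+ 0) ys         ≡⟨ +-identityˡ (ρ-from (i ℕ.+ 0) ys) ⟨
    + 0 + ρ-from (i ℕ.+ 0) ys   ∎
  ρ-from-++ i (x ∷ xs) ys = begin
    t + ρ-from (suc i) (xs ++ ys)                                 ≡⟨ cong (λ r → t + r) (ρ-from-++ (suc i) xs ys) ⟩
    t + (ρ-from (suc i) xs + ρ-from (suc i ℕ.+ length xs) ys)     ≡⟨ +-assoc t _ _ ⟨
    t + ρ-from (suc i) xs + ρ-from (suc i ℕ.+ length xs) ys       ≡⟨ cong (λ j → t + ρ-from (suc i) xs + ρ-from j ys) (ℕ.+-suc i (length xs)) ⟨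
    t + ρ-from (suc i) xs + ρ-from (i ℕ.+ suc (length xs)) ys     ∎
    where
    t : ℤ
    t = (+ x * (+ x - + 2 * + i + + 1)) / + 2

  ρ-from-replicate : ∀ i k x → ρ-from i (replicate k x) * + 2 ≡ + k * + x * (+ x - + 2 * + i - + k + + 2)
  ρ-from-replicate i zero x = refl
  ρ-from-replicate i (suc k) x = begin
    ρ-from i (x ∷ replicate k x) * + 2
      ≡⟨ ρ-from-∷ i x (replicate k x) ⟩
    + x * (+ x - + 2 * + i + + 1) + ρ-from (suc i) (replicate k x) * + 2
      ≡⟨ cong (λ r → + x * (+ x - + 2 * + i + + 1) + r) (ρ-from-replicate (suc i) k x) ⟩
    + x * (+ x - + 2 * + i + + 1) + + k * + x * (+ x - + 2 * + suc i - + k + + 2)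
      ≡⟨ first+rest (+ i) (+ k) (+ x) ⟩
    + suc k * + x * (+ x - + 2 * + i - + suc k + + 2) ∎
    where
    first+rest : ∀ I K X → X * (X - + 2 * I + + 1) + K * X * (X - + 2 * (+ 1 + I) - K + + 2)
                           ≡ (+ 1 + K) * X * (X - + 2 * I - (+ 1 + K) + + 2)
    first+rest = solve-∀

  ρ-shape : ∀ p q r k m → ρ (shape p q r k m) * + 2
            ≡ + p * (+ p - + 1) + + q * (+ q - + 3) + + r * (+ r - + 5)
              - + 2 * + k * (+ k + + 4) - + m * (+ m + + 2 * + k + + 5)
  ρ-shape p q r k m = begin
    ρ-from 1 (p ∷ q ∷ r ∷ twos ++ ones) * + 2
      ≡⟨ ρ-from-∷ 1 p (q ∷ r ∷ twos ++ ones) ⟩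
    row 1 p + ρ-from 2 (q ∷ r ∷ twos ++ ones) * + 2
      ≡⟨ cong (λ x → row 1 p + x) (ρ-from-∷ 2 q (r ∷ twos ++ ones)) ⟩
    row 1 p + (row 2 q + ρ-from 3 (r ∷ twos ++ ones) * + 2)
      ≡⟨ cong (λ x → row 1 p + (row 2 q + x)) (ρ-from-∷ 3 r (twos ++ ones)) ⟩
    row 1 p + (row 2 q + (row 3 r + ρ-from 4 (twos ++ ones) * + 2))
      ≡⟨ cong (λ x → row 1 p + (row 2 q + (row 3 r + x))) tail ⟩
    row 1 p + (row 2 q + (row 3 r + (+ k * + 2 * (+ 2 - + 2 * + 4 - + k + + 2)
                                     + + m * + 1 * (+ 1 - + 2 * (+ 4 + + k) - + m + + 2))))
      ≡⟨ collect (+ p) (+ q) (+ r) (+ k) (+ m) ⟩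
    + p * (+ p - + 1) + + q * (+ q - + 3) + + r * (+ r - + 5) - + 2 * + k * (+ k + + 4) - + m * (+ m + + 2 * + k + + 5) ∎
    where
    twos ones : List ℕ
    twos = replicate k 2
    ones = replicate m 1
    row : ℕ → ℕ → ℤ
    row i l = + l * (+ l - + 2 * + i + + 1)
    tail : ρ-from 4 (twos ++ ones) * + 2
           ≡ + k * + 2 * (+ 2 - + 2 * + 4 - + k + + 2) + + m * + 1 * (+ 1 - + 2 * (+ 4 + + k) - + m + + 2)
    tail = begin
      ρ-from 4 (twos ++ ones) * + 2
        ≡⟨ cong (_* + 2) (ρ-from-++ 4 twos ones) ⟩
      (ρ-from 4 twos + ρ-from (4 ℕ.+ length twos) ones) * + 2
        ≡⟨ *-distribʳ-+ (+ 2) (ρ-from 4 twos) _ ⟩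
      ρ-from 4 twos * + 2 + ρ-from (4 ℕ.+ length twos) ones * + 2
        ≡⟨ cong (λ j → ρ-from 4 twos * + 2 + ρ-from (4 ℕ.+ j) ones * + 2) (length-replicate k) ⟩
      ρ-from 4 twos * + 2 + ρ-from (4 ℕ.+ k) ones * + 2
        ≡⟨ cong₂ _+_ (ρ-from-replicate 4 k 2) (ρ-from-replicate (4 ℕ.+ k) m 1) ⟩
      + k * + 2 * (+ 2 - + 2 * + 4 - + k + + 2) + + m * + 1 * (+ 1 - + 2 * (+ 4 + + k) - + m + + 2) ∎
    collect : ∀ P Q R K M →
      P * (P - + 2 * + 1 + + 1) + (Q * (Q - + 2 * + 2 + + 1) + (R * (R - + 2 * + 3 + + 1)
        + (K * + 2 * (+ 2 - + 2 * + 4 - K + + 2) + M * + 1 * (+ 1 - + 2 * (+ 4 + K) - M + + 2))))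
      ≡ P * (P - + 1) + Q * (Q - + 3) + R * (R - + 5) - + 2 * K * (K + + 4) - M * (M + + 2 * K + + 5)
    collect = solve-∀

  ρ-parametrised-shape : ∀ β σ t → ρ (shape (5 ℕ.+ β ℕ.+ σ ℕ.+ t) (5 ℕ.+ β ℕ.+ σ) (4 ℕ.+ β) (1 ℕ.+ β) (1 ℕ.+ σ ℕ.+ t))
                ≡ + ((4 ℕ.+ β ℕ.+ σ) C 2) - + (2 ℕ.+ β)
  ρ-parametrised-shape β σ t = *-cancelʳ-≡ _ _ (+ 2) (begin
    ρ (shape p q r k m) * + 2
      ≡⟨ ρ-shape p q r k m ⟩
    + p * (+ p - + 1) + + q * (+ q - + 3) + + r * (+ r - + 5) - + 2 * + k * (+ k + + 4) - + m * (+ m + + 2 * + k + + 5)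
      ≡⟨ evaluate (+ β) (+ σ) (+ t) ⟩
    + suc a-1 * + a-1 - + b * + 2
      ≡⟨ cong (_- + b * + 2) (+[1+n]C2*2≡+[1+n]*+n a-1) ⟨
    + (suc a-1 C 2) * + 2 - + b * + 2
      ≡⟨ [i-j]*k≡i*k-j*k (+ (suc a-1 C 2)) (+ b) (+ 2) ⟨
    (+ (suc a-1 C 2) - + b) * + 2 ∎)
    where
    p q r k m a-1 b : ℕ
    p = 5 ℕ.+ β ℕ.+ σ ℕ.+ t
    q = 5 ℕ.+ β ℕ.+ σ
    r = 4 ℕ.+ β
    k = 1 ℕ.+ β
    m = 1 ℕ.+ σ ℕ.+ t
    a-1 = 3 ℕ.+ β ℕ.+ σ
    b = 2 ℕ.+ β
    evaluate : ∀ B S T → let P = + 5 + B + S + T; Q = + 5 + B + S; R = + 4 + B; K = + 1 + B; M = + 1 + S + T in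
      P * (P - + 1) + Q * (Q - + 3) + R * (R - + 5) - + 2 * K * (K + + 4) - M * (M + + 2 * K + + 5)
      ≡ (+ 1 + (+ 3 + B + S)) * (+ 3 + B + S) - (+ 2 + B) * + 2
    evaluate = solve-∀

open import Data.Nat using (_≤_; _≥_; _∸_; _+_; _*_; _/_; _%_; z≤n; s≤s)
open import Data.Integer using (+_; _-_)
open import Data.Product using (_×_; _,_; ∃-syntax)
open import Data.Nat.ListAction using (sum)
open import Data.Nat.ListAction.Properties using (sum-++)
open import Data.List.Relation.Unary.All using (All; _∷_)
open import Data.List.Relation.Unary.All.Properties using (++⁺; replicate⁺)
open import Data.List.Relation.Unary.Linked using (Linked; []; [-]; _∷_)
open import Data.Nat.Tactic.RingSolver using (solve-∀)
open import Relation.Binary.Core using (Rel)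
open import Relation.Binary.Definitions using (Reflexive)
open Eigenvalue using (ρ-parametrised-shape)

sum-replicate : ∀ k x → sum (replicate k x) ≡ k * x
sum-replicate zero x = refl
sum-replicate (suc k) x = cong (_+_ x) (sum-replicate k x)

replicate-linked : ∀ {a ℓ} {A : Set a} {R : Rel A ℓ} → Reflexive R → ∀ k x → Linked R (replicate k x)
replicate-linked refl-R zero x = []
replicate-linked refl-R (suc zero) x = [-]
replicate-linked refl-R (suc (suc k)) x = refl-R ∷ replicate-linked refl-R (suc k) x

twos-ones-linked : ∀ {r} k m → 2 ≤ r → Linked _≥_ (r ∷ replicate k 2 ++ replicate m 1)
twos-ones-linked zero zero 2≤r = [-]
twos-ones-linked zero (suc m) 2≤r = ℕ.≤-trans (s≤s z≤n) 2≤r ∷ replicate-linked ℕ.≤-refl (suc m) 1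
twos-ones-linked (suc k) m 2≤r = 2≤r ∷ twos-ones-linked k m ℕ.≤-refl

shape-isPartition : ∀ {n p q r} k m → p + q + r + 2 * k + m ≡ n → 2 ≤ r → r ≤ q → q ≤ p
                    → IsPartitionOf n (shape p q r k m)
shape-isPartition {n} {p} {q} {r} k m total 2≤r r≤q q≤p = sum-shape , positive , sorted
  where
  open ≡-Reasoning
  twos ones : List ℕ
  twos = replicate k 2
  ones = replicate m 1
  sum-shape : sum (shape p q r k m) ≡ n
  sum-shape = begin
    p + (q + (r + sum (twos ++ ones)))         ≡⟨ cong (λ s → p + (q + (r + s))) (sum-++ twos ones) ⟩
    p + (q + (r + (sum twos + sum ones)))      ≡⟨ cong₂ (λ x y → p + (q + (r + (x + y)))) (sum-replicate k 2) (sum-replicate m 1) ⟩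
    p + (q + (r + (k * 2 + m * 1)))            ≡⟨ reassociate p q r k m ⟩
    p + q + r + 2 * k + m                      ≡⟨ total ⟩
    n                                          ∎
    where
    reassociate : ∀ p q r k m → p + (q + (r + (k * 2 + m * 1))) ≡ p + q + r + 2 * k + m
    reassociate = solve-∀
  0<r : 0 ℕ.< r
  0<r = ℕ.≤-trans (s≤s z≤n) 2≤r
  0<q : 0 ℕ.< q
  0<q = ℕ.≤-trans 0<r r≤q
  positive : All (0 ℕ.<_) (shape p q r k m)
  positive = ℕ.≤-trans 0<q q≤p ∷ 0<q ∷ 0<r ∷ ++⁺ (replicate⁺ k (s≤s z≤n)) (replicate⁺ m (s≤s z≤n))
  sorted : Linked _≥_ (shape p q r k m)
  sorted = q≤p ∷ r≤q ∷ twos-ones-linked k m 2≤r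

half-of-difference : ∀ {x y} m → x ≡ m * 2 + y → (x ∸ y) / 2 ≡ m
half-of-difference {y = y} m refl = trans (cong (_/ 2) (ℕ.m+n∸n≡m (m * 2) y)) (ℕ.m*n/n≡m m 2)

λ₃₃≡shape : ∀ β σ t → λ₃₃ (17 + 5 * β + 3 * σ + 2 * t) (4 + β + σ) (2 + β)
                      ≡ shape (5 + β + σ + t) (5 + β + σ) (4 + β) (1 + β) (1 + σ + t)
λ₃₃≡shape β σ t = begin
  shape ((n ∸ a + 1 ∸ 2 * b) / 2) (a + 1) (b + 2) (1 + β) ((n ∸ a ∸ 3 ∸ 4 * b) / 2)
    ≡⟨ cong₂ (λ p m → shape p (a + 1) (b + 2) (1 + β) m) first-row ones ⟩
  shape (5 + β + σ + t) (a + 1) (b + 2) (1 + β) (1 + σ + t)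
    ≡⟨ cong₂ (λ q r → shape (5 + β + σ + t) q r (1 + β) (1 + σ + t)) (ℕ.+-comm a 1) (ℕ.+-comm b 2) ⟩
  shape (5 + β + σ + t) (5 + β + σ) (4 + β) (1 + β) (1 + σ + t) ∎
  where
  open ≡-Reasoning
  n a b : ℕ
  n = 17 + 5 * β + 3 * σ + 2 * t
  a = 4 + β + σ
  b = 2 + β
  n∸a : n ∸ a ≡ 13 + 4 * β + 2 * σ + 2 * t
  n∸a = trans (cong (_∸ a) (split β σ t)) (ℕ.m+n∸n≡m _ a)
    where
    split : ∀ β σ t → 17 + 5 * β + 3 * σ + 2 * t ≡ (13 + 4 * β + 2 * σ + 2 * t) + (4 + β + σ)
    split = solve-∀
  first-row : (n ∸ a + 1 ∸ 2 * b) / 2 ≡ 5 + β + σ + t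
  first-row = half-of-difference _ (trans (cong (_+ 1) n∸a) (split β σ t))
    where
    split : ∀ β σ t → 13 + 4 * β + 2 * σ + 2 * t + 1 ≡ (5 + β + σ + t) * 2 + 2 * (2 + β)
    split = solve-∀
  ones : (n ∸ a ∸ 3 ∸ 4 * b) / 2 ≡ 1 + σ + t
  ones = trans (cong (_/ 2) (ℕ.∸-+-assoc (n ∸ a) 3 (4 * b))) (half-of-difference _ (trans n∸a (split β σ t)))
    where
    split : ∀ β σ t → 13 + 4 * β + 2 * σ + 2 * t ≡ (1 + σ + t) * 2 + (3 + 4 * (2 + β))
    split = solve-∀

odd-gap : ∀ {n a} → (n ∸ a) % 2 ≡ 1 → ∃[ c ] n ≡ a + suc (c * 2)
odd-gap {n} {a} odd = (n ∸ a) / 2 , (begin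
  n                                      ≡⟨ ℕ.m+[n∸m]≡n a≤n ⟨
  a + (n ∸ a)                            ≡⟨ cong (_+_ a) (ℕ.m≡m%n+[m/n]*n (n ∸ a) 2) ⟩
  a + ((n ∸ a) % 2 + (n ∸ a) / 2 * 2)    ≡⟨ cong (λ x → a + (x + (n ∸ a) / 2 * 2)) odd ⟩
  a + suc ((n ∸ a) / 2 * 2)              ∎)
  where
  open ≡-Reasoning
  a≤n : a ≤ n
  a≤n = ℕ.<⇒≤ (ℕ.m∸n≢0⇒n<m (λ n∸a≡0 → ℕ.0≢1+n (trans (cong (_% 2) (sym n∸a≡0)) odd)))

gap-bound : ∀ {β σ c} → (4 + β + σ) * 5 ≤ 4 + β + σ + suc (c * 2) + 3 → 6 + 2 * β + 2 * σ ≤ c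
gap-bound {β} {σ} {c} 5a≤ =
  ℕ.*-cancelʳ-≤ _ c 2 (ℕ.+-cancelʳ-≤ (8 + β + σ) _ _ (subst₂ _≤_ (lhs β σ) (rhs β σ c) 5a≤))
  where
  lhs : ∀ β σ → (4 + β + σ) * 5 ≡ (6 + 2 * β + 2 * σ) * 2 + (8 + β + σ)
  lhs = solve-∀
  rhs : ∀ β σ c → 4 + β + σ + suc (c * 2) + 3 ≡ c * 2 + (8 + β + σ)
  rhs = solve-∀

Parametrised : ℕ → ℕ → ℕ → Set
Parametrised n a b = ∃[ β ] ∃[ σ ] ∃[ t ] n ≡ 17 + 5 * β + 3 * σ + 2 * t × a ≡ 4 + β + σ × b ≡ 2 + β

excess-parametrised : ∀ β σ {c} → ∃[ u ] 6 + 2 * β + 2 * σ + u ≡ c → Parametrised (4 + β + σ + suc (c * 2)) (4 + β + σ) (2 + β)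
excess-parametrised β σ (u , refl) = β , σ , σ + u , expand β σ u , refl , refl
  where
  expand : ∀ β σ u → 4 + β + σ + suc ((6 + 2 * β + 2 * σ + u) * 2) ≡ 17 + 5 * β + 3 * σ + 2 * (σ + u)
  expand = solve-∀

gap-parametrised : ∀ {n a b} → 4 ≤ a → a * 5 ≤ n + 3 → ∃[ c ] n ≡ a + suc (c * 2) → 2 ≤ b → b ≤ a ∸ 2
                   → Parametrised n a b
gap-parametrised (s≤s (s≤s (s≤s (s≤s z≤n)))) 5a≤ (c , refl) (s≤s (s≤s (z≤n {β}))) (s≤s (s≤s β≤a-4))
  with σ , refl ← ℕ.m≤n⇒∃[o]m+o≡n β≤a-4 =
  excess-parametrised β σ (ℕ.m≤n⇒∃[o]m+o≡n (gap-bound {β} {σ} {c} 5a≤))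

admissible-parametrised : ∀ {n a b} → 4 ≤ a → a ≤ (n + 3) / 5 → (n ∸ a) % 2 ≡ 1 → 2 ≤ b → b ≤ a ∸ 2
                          → Parametrised n a b
admissible-parametrised 4≤a a≤ odd =
  gap-parametrised 4≤a (ℕ.≤-trans (ℕ.*-monoˡ-≤ 5 a≤) (ℕ.m/n*n≤m _ 5)) (odd-gap odd)

λ₃₃-parametrised : ∀ β σ t → let n = 17 + 5 * β + 3 * σ + 2 * t; a = 4 + β + σ; b = 2 + β in
                   IsPartitionOf n (λ₃₃ n a b) × ρ (λ₃₃ n a b) ≡ + (a C 2) - + b
λ₃₃-parametrised β σ t = subst (λ l → IsPartitionOf n l × ρ l ≡ + ((4 + β + σ) C 2) - + (2 + β))
  (sym (λ₃₃≡shape β σ t))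
  (shape-isPartition (1 + β) (1 + σ + t) (total β σ t) (s≤s (s≤s z≤n)) r≤q (ℕ.m≤m+n (5 + β + σ) t) , ρ-parametrised-shape β σ t)
  where
  n : ℕ
  n = 17 + 5 * β + 3 * σ + 2 * t
  r≤q : 4 + β ≤ 5 + β + σ
  r≤q = ℕ.≤-trans (ℕ.n≤1+n (4 + β)) (ℕ.m≤m+n (5 + β) σ)
  total : ∀ β σ t → 5 + β + σ + t + (5 + β + σ) + (4 + β) + 2 * (1 + β) + (1 + σ + t) ≡ 17 + 5 * β + 3 * σ + 2 * t
  total = solve-∀

lemma3p3 : (n a b : ℕ) → 17 ≤ n → 4 ≤ a → a ≤ (n + 3) / 5 → (n ∸ a) % 2 ≡ 1
    → 2 ≤ b → b ≤ a ∸ 2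
    → IsPartitionOf n (λ₃₃ n a b) × ρ (λ₃₃ n a b) ≡ (+ (a C 2)) - (+ b)
-- The hypothesis 17 ≤ n is implied by 4 ≤ a ≤ (n + 3) / 5.
lemma3p3 n a b _ 4≤a a≤ odd 2≤b b≤a-2 with admissible-parametrised 4≤a a≤ odd 2≤b b≤a-2
... | β , σ , t , refl , refl , refl = λ₃₃-parametrised β σ t
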